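{- Under the standing assumptions below, let $H$ be the group of permutations of $X$ generated under composition by the maps $\varphi_x$, $x\in A$, acting on $X$ on the right. Then the action of $H$ on $X$ is transitive.
   Context: Let $A$ be a finite alphabet (with a pairing of letters into formal inverses), $W$ a finite state automaton over $A$ with $L=L(W)$, and for each $x\in A\sqcup\{\epsilon\}$ let $M_x$ be a two-tape boundedly asynchronous automaton over $A$ with $L_x=L(M_x)$. (A two-tape asynchronous automaton is a partial deterministic automaton over $A\sqcup\{\$\}$ with states split into left and right sets, accepting $(u,v)$ iff some path from the start state to an accept state has labels read from left-set states concatenating to $u\$$ and from right-set states to $v\$$; bounded means some $k$ bounds the number of consecutive letters read from one tape.) Assume the following axioms, all variables ranging over $A^\ast$: 1. $\exists w\,(w\in L)$. 2. For $x\in A\cup\{\epsilon\}$, $(w,v)\in L_x\Rightarrow w\in L\wedge v\in L$. 3. $w\in L\Rightarrow (w,w)\in L_\epsilon$. 4. $(u,v)\in L_\epsilon\Rightarrow (v,u)\in L_\epsilon$. 5. $(u,v),(v,w)\in L_\epsilon\Rightarrow(u,w)\in L_\epsilon$. 6. For $x\in A$, $u\in L\Rightarrow\exists v\,(u,v)\in L_x$. 7. For $x\in A$, $(u,v)\in L_x\wedge(v,w)\in L_\epsilon\Rightarrow(u,w)\in L_x$. 8. For $x\in A$, $(u,v)\in L_\epsilon\wedge(u,w)\in L_x\Rightarrow(v,w)\in L_x$. 9. For $x\in A$, $v\in L\Rightarrow\exists u\,(u,v)\in L_x$. 10. For $x\in A$, $(u,v)\in L_x\wedge(u,w)\in L_\epsilon\Rightarrow(w,v)\in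 L_x$. 11. For $x\in A$, $(u,v)\in L_\epsilon\wedge(w,u)\in L_x\Rightarrow(w,v)\in L_x$. 12. If $uw\in L$ and $uw'\in L$ then for all $v$: $[v]\varphi_w=[uw]\iff[v]\varphi_{w'}=[uw']$. 13. With $c$ the maximal number of states of $W,M_\epsilon,M_x$ and $k$ the largest boundedness factor of the $M_x,M_\epsilon$: for each word $w$ of length $\le 2c+2k$, $(\exists u\,[u]\varphi_w=[u])\Rightarrow(\forall u\,[u]\varphi_w=[u])$. Here, for $w=\sigma_1\cdots\sigma_m$ ($\sigma_i\in A$), "$[v]\varphi_w=[u]$" in Axioms 12–13 abbreviates $\exists v_1,\dots,v_{m-1}$ with $(v,v_1)\in L_{\sigma_1},\dots,(v_{m-1},u)\in L_{\sigma_m}$. By Axioms 3–5, $u\sim v\iff(u,v)\in L_\epsilon$ is an equivalence relation on $L$; $X$ is its set of classes, $[u]$ the class of $u\in L$. For $x\in A$, $\varphi_x:X\to X$ is the (unique, invertible) map with $[u]\varphi_x=[v]\iff(u,v)\in L_x$ for $u,v\in L$. -}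

module Defs where

open import Data.Nat using (ℕ; zero; suc; _+_; _*_; _≤_; _⊔_)
open import Data.Fin using (Fin)
open import Data.List using (List; []; _∷_; _++_; [_]; map; length; foldr; allFin)
open import Data.Maybe using (Maybe; just; nothing)
open import Data.Bool using (Bool; true)
open import Data.Product using (Σ; Σ-syntax; ∃; ∃-syntax; _×_; _,_)
open import Data.Unit using (⊤)
open import Relation.Nullary using (¬_)
open import Relation.Binary.PropositionalEquality using (_≡_)
open import Function.Bundles using (_⇔_)

Word : ℕ → Set
Word n = List (Fin n)

IsFormalInverse : {n : ℕ} → (Fin n → Fin n) → Set
IsFormalInverse {n} inv = (a : Fin n) → inv (inv a) ≡ a

record FSA (n : ℕ) : Set where
  field
    states : ℕ
    start  : Fin states
    accept : Fin states → Bool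
    δ      : Fin states → Fin n → Maybe (Fin states)

module _ {n : ℕ} (W : FSA n) where
  open FSA W

  runFSA : Fin states → Word n → Maybe (Fin states)
  runFSA q [] = just q
  runFSA q (a ∷ w) with δ q a
  ... | nothing = nothing
  ... | just q' = runFSA q' w

  AcceptsFSA : Word n → Set
  AcceptsFSA w = Σ[ q ∈ Fin states ] (runFSA start w ≡ just q × accept q ≡ true)

-- Two-tape asynchronous automaton over A ⊔ {$}
-- letters of A ⊔ {$} are Maybe (Fin n), with nothing = $.

data Tape : Set where
  leftTape rightTape : Tape

record TwoTapeAutomaton (n : ℕ) : Set where
  field
    states : ℕ
    start  : Fin states
    accept : Fin states → Bool
    side   : Fin states → Tape
    δ      : Fin states → Maybe (Fin n) → Maybe (Fin states)

dollar : {n : ℕ} → Word n → List (Maybe (Fin n))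
dollar u = map just u ++ [ nothing ]

module _ {n : ℕ} (M : TwoTapeAutomaton n) where
  open TwoTapeAutomaton M

  data Path : Fin states → List (Maybe (Fin n)) → List (Maybe (Fin n)) → Fin states → Set where
    stop  : ∀ {q} → Path q [] [] q
    stepL : ∀ {q q' q'' a l r} → side q ≡ leftTape → δ q a ≡ just q' →
            Path q' l r q'' → Path q (a ∷ l) r q''
    stepR : ∀ {q q' q'' a l r} → side q ≡ rightTape → δ q a ≡ just q' →
            Path q' l r q'' → Path q l (a ∷ r) q''

  Accepts2 : Word n → Word n → Set
  Accepts2 u v = Σ[ q ∈ Fin states ] (Path start (dollar u) (dollar v) q × accept q ≡ true)

  Reachable : Fin states → Set
  Reachable q = Σ[ l ∈ List (Maybe (Fin n)) ] Σ[ r ∈ List (Maybe (Fin n)) ] Path start l r q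

  SideRun : Tape → Fin states → ℕ → Set
  SideRun t q zero = ⊤
  SideRun t q (suc m) = side q ≡ t × Σ[ a ∈ Maybe (Fin n) ] Σ[ q' ∈ Fin states ] (δ q a ≡ just q' × SideRun t q' m)

  BoundedBy : ℕ → Set
  BoundedBy k = (q : Fin states) → Reachable q → (t : Tape) → ¬ SideRun t q (suc k)

-- The standing data: W and M_x for x ∈ A ⊔ {ε}, with ε = nothing.

module Setup {n : ℕ} (W : FSA n) (M : Maybe (Fin n) → TwoTapeAutomaton n) where

  L : Word n → Set
  L = AcceptsFSA W

  Lx : Fin n → Word n → Word n → Set
  Lx x = Accepts2 (M (just x))

  Lε : Word n → Word n → Set
  Lε = Accepts2 (M nothing)

  -- "[v]φ_w = [u]" for w = σ₁⋯σₘ : ∃ v₁ … v_{m-1} with (v,v₁) ∈ L_σ₁, …, (v_{m-1},u) ∈ L_σₘ;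
  -- for the empty word, [v]φ_ε = [u] means (v,u) ∈ L_ε.
  Phi : Word n → Word n → Word n → Set
  Phi v [] u = Lε v u
  Phi v (σ ∷ []) u = Lx σ v u
  Phi v (σ ∷ τ ∷ w) u = Σ[ v₁ ∈ Word n ] (Lx σ v v₁ × Phi v₁ (τ ∷ w) u)

  c : ℕ
  c = FSA.states W ⊔ foldr _⊔_ 0 (map (λ x → TwoTapeAutomaton.states (M x)) (nothing ∷ map just (allFin n)))

  record StandingAxioms (k : ℕ) : Set where
    field
      ax1  : Σ[ w ∈ Word n ] L w
      ax2  : (x : Maybe (Fin n)) → ∀ w v → Accepts2 (M x) w v → L w × L v
      ax3  : ∀ w → L w → Lε w w
      ax4  : ∀ u v → Lε u v → Lε v u
      ax5  : ∀ u v w → Lε u v → Lε v w → Lε u w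
      ax6  : ∀ x u → L u → Σ[ v ∈ Word n ] Lx x u v
      ax7  : ∀ x u v w → Lx x u v → Lε v w → Lx x u w
      ax8  : ∀ x u v w → Lε u v → Lx x u w → Lx x v w
      ax9  : ∀ x v → L v → Σ[ u ∈ Word n ] Lx x u v
      ax10 : ∀ x u v w → Lx x u v → Lε u w → Lx x w v
      ax11 : ∀ x u v w → Lε u v → Lx x w u → Lx x w v
      ax12 : ∀ u w w' → L (u ++ w) → L (u ++ w') →
             ∀ v → Phi v w (u ++ w) ⇔ Phi v w' (u ++ w')
      ax13 : ∀ w → length w ≤ 2 * c + 2 * k →
             (Σ[ u ∈ Word n ] Phi u w u) → ∀ u → L u → Phi u w u

  -- [u] h = [v] for some h in the group H generated by the φ_x (x ∈ A):
  -- h is a finite product of φ_x and φ_x⁻¹; [a]φ_x = [b] ⇔ (a,b) ∈ L_x,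
  -- [a]φ_x⁻¹ = [b] ⇔ (b,a) ∈ L_x, and the identity is [a] = [b] ⇔ (a,b) ∈ L_ε.
  data HRelated : Word n → Word n → Set where
    hId  : ∀ {u v} → Lε u v → HRelated u v
    hFwd : ∀ {u w v} (x : Fin n) → Lx x u w → HRelated w v → HRelated u v
    hBwd : ∀ {u w v} (x : Fin n) → Lx x w u → HRelated w v → HRelated u v

  HTransitive : Set
  HTransitive = ∀ u v → L u → L v → HRelated u v

{-# OPTIONS --safe #-}
-- Axiom 12 with u empty says that, for words w ∈ L, whether [v]φ_w = [w]
-- holds does not depend on w. Since each φ_x is onto, some v satisfies it
-- for one w₀ ∈ L, hence for every w ∈ L: the class [v] is a base point
-- sent to every [w] by the group element φ_w, so H acts transitively.
module Submission where

open import Defs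
open import Data.Nat using (ℕ)
open import Data.Fin using (Fin)
open import Data.Maybe using (Maybe)
open import Data.List using ([]; _∷_)
open import Data.Product using (Σ-syntax; _×_; _,_; proj₁; proj₂)
open import Function.Bundles using (Equivalence)

module Transitivity {n : ℕ} (W : FSA n) (M : Maybe (Fin n) → TwoTapeAutomaton n) {k : ℕ}
                    (S : Setup.StandingAxioms W M k) where
  open Setup W M
  open StandingAxioms S

  Accepts2⇒L-left : ∀ {x u v} → Accepts2 (M x) u v → L u
  Accepts2⇒L-left {x} {u} {v} p = proj₁ (ax2 x u v p)

  Accepts2⇒L-right : ∀ {x u v} → Accepts2 (M x) u v → L v
  Accepts2⇒L-right {x} {u} {v} p = proj₂ (ax2 x u v p)

  Lε-HRelated-trans : ∀ {u v w} → Lε u v → HRelated v w → HRelated u w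
  Lε-HRelated-trans e (hId e′)      = hId (ax5 _ _ _ e e′)
  Lε-HRelated-trans e (hFwd x p r)  = hFwd x (ax8 x _ _ _ (ax4 _ _ e) p) r
  Lε-HRelated-trans e (hBwd x p r)  = hBwd x (ax11 x _ _ _ (ax4 _ _ e) p) r

  HRelated-trans : ∀ {u v w} → HRelated u v → HRelated v w → HRelated u w
  HRelated-trans (hId e)      r′ = Lε-HRelated-trans e r′
  HRelated-trans (hFwd x p r) r′ = hFwd x p (HRelated-trans r r′)
  HRelated-trans (hBwd x p r) r′ = hBwd x p (HRelated-trans r r′)

  HRelated-sym : ∀ {u v} → HRelated u v → HRelated v u
  HRelated-sym (hId e) = hId (ax4 _ _ e)
  HRelated-sym {u} (hFwd x p r) =
    HRelated-trans (HRelated-sym r) (hBwd x p (hId (ax3 u (Accepts2⇒L-left p))))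
  HRelated-sym {u} (hBwd x p r) =
    HRelated-trans (HRelated-sym r) (hFwd x p (hId (ax3 u (Accepts2⇒L-right p))))

  Phi⇒HRelated : ∀ v w u → Phi v w u → HRelated v u
  Phi⇒HRelated v []           u p            = hId p
  Phi⇒HRelated v (σ ∷ [])     u p            = hFwd σ p (hId (ax3 u (Accepts2⇒L-right p)))
  Phi⇒HRelated v (σ ∷ τ ∷ w) u (v₁ , p , r) = hFwd σ p (Phi⇒HRelated v₁ (τ ∷ w) u r)

  Phi-preimage : ∀ w u → L u → Σ[ v ∈ Word n ] (Phi v w u × L v)
  Phi-preimage []       u lu = u , ax3 u lu , lu
  Phi-preimage (σ ∷ []) u lu =
    let v , p = ax9 σ u lu in v , p , Accepts2⇒L-left p
  Phi-preimage (σ ∷ τ ∷ w) u lu =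
    let v₁ , r , lv₁ = Phi-preimage (τ ∷ w) u lu
        v , p        = ax9 σ v₁ lv₁
    in v , (v₁ , p , r) , Accepts2⇒L-left p

  basepoint : Σ[ v ∈ Word n ] (∀ w → L w → Phi v w w)
  basepoint =
    let w₀ , lw₀    = ax1
        v , p , _   = Phi-preimage w₀ w₀ lw₀
    in v , λ w lw → Equivalence.to (ax12 [] w₀ w lw₀ lw v) p

  HRelated-from-basepoint : ∀ w → L w → HRelated (proj₁ basepoint) w
  HRelated-from-basepoint w lw = Phi⇒HRelated _ w w (proj₂ basepoint w lw)

  transitive : HTransitive
  transitive u v lu lv =
    HRelated-trans (HRelated-sym (HRelated-from-basepoint u lu)) (HRelated-from-basepoint v lv)

mainTheorem9 : {n : ℕ} (inv : Fin n → Fin n) → IsFormalInverse inv →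
    (W : FSA n) (M : Maybe (Fin n) → TwoTapeAutomaton n) (k : ℕ) →
    ((x : Maybe (Fin n)) → BoundedBy (M x) k) →
    Setup.StandingAxioms W M k →
    Setup.HTransitive W M
mainTheorem9 _ _ W M _ _ S = Transitivity.transitive W M S
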